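{- Let $k\ge 2$, let $\mathcal I$ be a $k\mathsf{XOR}$ instance on variables $[n]$, let $S_1,\dots,S_\ell$ be a partition of $[n]$, and let $t\ge 0$. Suppose that for each $i\in[\ell]$ and each $\sigma\in\{\pm1\}^{S_i}$, the number of assignments in $\{\pm1\}^{[n]\setminus S_i}$ that violate at most $\lfloor kt/\ell\rfloor$ constraints of the induced $(k-1)\mathsf{XOR}$ instance $\mathcal I_{S_i,\sigma}$ is at most $u_i$. Then the number of assignments $x\in\{\pm1\}^n$ violating at most $t$ constraints of $\mathcal I$ is at most $\sum_{i=1}^\ell 2^{|S_i|}u_i$.
   Context: A $k\mathsf{XOR}$ instance on $[n]$ is a collection of constraints $(b,U)$ with $b\in\{\pm1\}$ and $U\in[n]^k$ an ordered tuple; $x\in\{\pm1\}^n$ satisfies $(b,U)$ iff $\prod_{i=1}^k x_{U[i]}=b$, and otherwise violates it. Given $S\subseteq[n]$ and $\sigma\in\{\pm1\}^S$, the induced $(k-1)\mathsf{XOR}$ instance $\mathcal I_{S,\sigma}$ on variables $[n]\setminus S$ is defined as follows: for each constraint $(b,U)\in\mathcal I$ with $U[1]\in S$ and $U[2],\dots,U[k]\in[n]\setminus S$, it contains the constraint $(b\cdot\sigma_{U[1]},(U[2],\dots,U[k]))$. -}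

module Defs where

open import Data.Bool using (Bool; true; false; _xor_; _∧_; not; if_then_else_)
open import Data.Nat using (ℕ; zero; suc; _+_; _≤ᵇ_; pred)
open import Data.Fin using (Fin)
open import Data.Vec using (Vec; []; _∷_; lookup; map; foldr)
open import Data.List using (List; []; _∷_; _++_)
open import Data.Product using (_×_; _,_)
open import Data.Fin.Subset using (Subset)

-- Sign convention: a value in {±1} is encoded as a Bool,
-- false = +1 and true = -1; the product of signs is then xor.
Sign : Set
Sign = Bool

Assignment : ℕ → Set
Assignment n = Vec Sign n

Constraint : ℕ → ℕ → Set
Constraint n k = Sign × Vec (Fin n) k

KXOR : ℕ → ℕ → Set
KXOR n k = List (Constraint n k)

prodOn : ∀ {n k} → Assignment n → Vec (Fin n) k → Sign
prodOn x U = foldr _ _xor_ false (map (lookup x) U)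

satisfiesᵇ : ∀ {n k} → Assignment n → Constraint n k → Bool
satisfiesᵇ x (b , U) = not (prodOn x U xor b)

violations : ∀ {n k} → Assignment n → KXOR n k → ℕ
violations x [] = 0
violations x (c ∷ I) = (if satisfiesᵇ x c then 0 else 1) + violations x I

_∈ᵇ_ : ∀ {n} → Fin n → Subset n → Bool
i ∈ᵇ S = lookup S i

allOutside : ∀ {n k} → Vec (Fin n) k → Subset n → Bool
allOutside [] S = true
allOutside (u ∷ us) S = not (u ∈ᵇ S) ∧ allOutside us S

-- Only the values of σ on S are used,
-- so σ is given as a full vector in {±1}^n. Variables of the induced
-- instance are the elements of [n] \ S (tuples only mention those).
inducedC : ∀ {n k} → Subset n → Assignment n → Constraint n k → KXOR n (pred k)
inducedC S σ (b , []) = []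
inducedC S σ (b , (u ∷ us)) =
  if (u ∈ᵇ S) ∧ allOutside us S then (b xor lookup σ u , us) ∷ [] else []

induced : ∀ {n k} → KXOR n k → Subset n → Assignment n → KXOR n (pred k)
induced [] S σ = []
induced (c ∷ I) S σ = inducedC S σ c ++ induced I S σ

allAssignments : (n : ℕ) → List (Assignment n)
allAssignments zero = [] ∷ []
allAssignments (suc n) =
  Data.List.map (false ∷_) (allAssignments n) ++ Data.List.map (true ∷_) (allAssignments n)

countᵇ : ∀ {A : Set} → (A → Bool) → List A → ℕ
countᵇ p [] = 0
countᵇ p (a ∷ as) = (if p a then 1 else 0) + countᵇ p as

fixedOn : ∀ {n} → Subset n → Assignment n → Bool
fixedOn [] [] = true
fixedOn (s ∷ S) (x ∷ xs) = (if s then not x else true) ∧ fixedOn S xs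

countLowViolation : ∀ {n k} → KXOR n k → ℕ → ℕ
countLowViolation {n} I t = countᵇ (λ x → violations x I ≤ᵇ t) (allAssignments n)

-- #{ y ∈ {±1}^{[n]∖S} : y violates at most t constraints of J },
-- where an assignment on [n]∖S is encoded (bijectively) as an
-- x ∈ {±1}^n equal to +1 on S.
countLowViolationOff : ∀ {n k} → Subset n → KXOR n k → ℕ → ℕ
countLowViolationOff {n} S J t =
  countᵇ (λ y → fixedOn S y ∧ (violations y J ≤ᵇ t)) (allAssignments n)

-- Take σ = x. A constraint (b , U) is induced in at most one block, the S_i containing U[1],
-- and there x violates it iff x violates (b , U). Hence the block violation counts of x sum
-- to at most the violations of x, so if x violates at most t constraints then some block i
-- has at most ⌊t/ℓ⌋ ≤ ⌊kt/ℓ⌋ induced violations, and a union bound over i remains. For a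
-- fixed i, split x into its part σ on S_i and its part y off S_i: the induced instance
-- depends only on σ and its violations only on y, so each of the 2^|S_i| choices of σ
-- contributes at most u_i.
module Submission where

open import Defs
open import Data.Bool using (Bool; true; false; not; _∧_; _xor_; if_then_else_; T)
open import Data.Bool.Properties using (xor-assoc; xor-comm; ¬-not)
open import Data.Fin using (Fin; zero; suc)
import Data.Fin.Properties as Fin
open import Data.Fin.Subset using (Subset; ∣_∣)
open import Data.List using (List; []; _∷_; _++_; map; tabulate)
open import Data.List.Properties using (map-++; map-∘; map-cong; tabulate-cong)
open import Data.List.Relation.Unary.All as All using (All; []; _∷_)
open import Data.List.Relation.Unary.All.Properties using (++⁺)
open import Data.Nat using (ℕ; zero; suc; _+_; _*_; _^_; _≤_; _≤ᵇ_; z≤n; s≤s; NonZero)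
open import Data.Nat.DivMod using (_/_; m*n/n≡m; /-monoˡ-≤)
open import Data.Nat.ListAction using (sum)
open import Data.Nat.ListAction.Properties using (sum-++)
open import Data.Nat.Properties
open import Algebra.Properties.CommutativeSemigroup +-commutativeSemigroup using (interchange)
open import Data.Product using (Σ; ∃; _,_; proj₁; proj₂)
open import Data.Unit using (tt)
open import Data.Vec using (Vec; []; _∷_; lookup)
import Data.Vec as Vec
open import Data.Vec.Properties using (lookup∘tabulate)
open import Function using (_∘_)
open import Relation.Binary.PropositionalEquality
open import Relation.Nullary using (yes; no)

𝟙 : Bool → ℕ
𝟙 b = if b then 1 else 0

T⇒1≤𝟙 : ∀ {b} → T b → 1 ≤ 𝟙 b
T⇒1≤𝟙 {true} _ = ≤-refl

module _ {A : Set} where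

  countᵇ≡sum-𝟙 : (p : A → Bool) (xs : List A) → countᵇ p xs ≡ sum (map (𝟙 ∘ p) xs)
  countᵇ≡sum-𝟙 p [] = refl
  countᵇ≡sum-𝟙 p (x ∷ xs) = cong (𝟙 (p x) +_) (countᵇ≡sum-𝟙 p xs)

  sum-map-+ : (f g : A → ℕ) (xs : List A) →
    sum (map (λ a → f a + g a) xs) ≡ sum (map f xs) + sum (map g xs)
  sum-map-+ f g [] = refl
  sum-map-+ f g (x ∷ xs) =
    trans (cong (f x + g x +_) (sum-map-+ f g xs)) (interchange (f x) (g x) _ _)

sum-allAssignments-suc : ∀ {n} (w : Assignment (suc n) → ℕ) →
  sum (map w (allAssignments (suc n)))
    ≡ sum (map (w ∘ (false ∷_)) (allAssignments n)) + sum (map (w ∘ (true ∷_)) (allAssignments n))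
sum-allAssignments-suc {n} w = begin
  sum (map w (map (false ∷_) xs ++ map (true ∷_) xs))
    ≡⟨ cong sum (map-++ w (map (false ∷_) xs) _) ⟩
  sum (map w (map (false ∷_) xs) ++ map w (map (true ∷_) xs))
    ≡⟨ sum-++ (map w (map (false ∷_) xs)) _ ⟩
  sum (map w (map (false ∷_) xs)) + sum (map w (map (true ∷_) xs))
    ≡⟨ cong₂ (λ as bs → sum as + sum bs) (map-∘ xs) (map-∘ xs) ⟨
  sum (map (w ∘ (false ∷_)) xs) + sum (map (w ∘ (true ∷_)) xs) ∎
  where
  open ≡-Reasoning
  xs = allAssignments n

sum-tabulate-+ : ∀ {ℓ} (f g : Fin ℓ → ℕ) →
  sum (tabulate (λ i → f i + g i)) ≡ sum (tabulate f) + sum (tabulate g)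
sum-tabulate-+ {zero} f g = refl
sum-tabulate-+ {suc ℓ} f g =
  trans (cong (f zero + g zero +_) (sum-tabulate-+ (f ∘ suc) (g ∘ suc)))
        (interchange (f zero) (g zero) _ _)

sum-tabulate-mono : ∀ {ℓ} {f g : Fin ℓ → ℕ} → (∀ i → f i ≤ g i) →
  sum (tabulate f) ≤ sum (tabulate g)
sum-tabulate-mono {zero} f≤g = z≤n
sum-tabulate-mono {suc ℓ} f≤g = +-mono-≤ (f≤g zero) (sum-tabulate-mono (f≤g ∘ suc))

sum-tabulate-0 : ∀ {ℓ} (f : Fin ℓ → ℕ) → (∀ i → f i ≡ 0) → sum (tabulate f) ≡ 0
sum-tabulate-0 {zero} f f≡0 = refl
sum-tabulate-0 {suc ℓ} f f≡0 = cong₂ _+_ (f≡0 zero) (sum-tabulate-0 (f ∘ suc) (f≡0 ∘ suc))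

sum-tabulate-single : ∀ {ℓ} (f : Fin ℓ → ℕ) i₀ → (∀ i → i ≢ i₀ → f i ≡ 0) →
  sum (tabulate f) ≡ f i₀
sum-tabulate-single {suc ℓ} f zero f≡0 =
  trans (cong (f zero +_) (sum-tabulate-0 (f ∘ suc) (λ i → f≡0 (suc i) λ ()))) (+-identityʳ _)
sum-tabulate-single {suc ℓ} f (suc i₀) f≡0 =
  cong₂ _+_ (f≡0 zero λ ())
            (sum-tabulate-single (f ∘ suc) i₀ (λ i i≢i₀ → f≡0 (suc i) (i≢i₀ ∘ Fin.suc-injective)))

≤-sum-tabulate : ∀ {ℓ} (f : Fin ℓ → ℕ) i → f i ≤ sum (tabulate f)
≤-sum-tabulate f zero = m≤m+n _ _
≤-sum-tabulate f (suc i) = ≤-trans (≤-sum-tabulate (f ∘ suc) i) (m≤n+m _ (f zero))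

∃-≤-average : ∀ ℓ .{{_ : NonZero ℓ}} (f : Fin ℓ → ℕ) → ∃ λ i → f i * ℓ ≤ sum (tabulate f)
∃-≤-average 1 f = zero , ≤-reflexive (trans (*-identityʳ (f zero)) (sym (+-identityʳ (f zero))))
∃-≤-average (suc ℓ@(suc _)) f with ∃-≤-average ℓ (f ∘ suc)
... | i , fi*ℓ≤ with f zero ≤? f (suc i)
...   | yes f₀≤fi = zero , (begin
  f zero * suc ℓ           ≡⟨ *-suc (f zero) ℓ ⟩
  f zero + f zero * ℓ      ≤⟨ +-monoʳ-≤ (f zero) (≤-trans (*-monoˡ-≤ ℓ f₀≤fi) fi*ℓ≤) ⟩
  sum (tabulate f)         ∎)
  where open ≤-Reasoning
...   | no f₀≰fi = suc i , (begin
  f (suc i) * suc ℓ        ≡⟨ *-suc (f (suc i)) ℓ ⟩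
  f (suc i) + f (suc i) * ℓ ≤⟨ +-mono-≤ (<⇒≤ (≰⇒> f₀≰fi)) fi*ℓ≤ ⟩
  sum (tabulate f)         ∎)
  where open ≤-Reasoning

count-≤-sum-count : ∀ {A : Set} {ℓ} (p : A → Bool) (q : Fin ℓ → A → Bool) →
  (∀ a → T (p a) → ∃ λ i → T (q i a)) →
  (xs : List A) → countᵇ p xs ≤ sum (tabulate (λ i → countᵇ (q i) xs))
count-≤-sum-count p q p⇒q [] = z≤n
count-≤-sum-count p q p⇒q (a ∷ xs) = begin
  𝟙 (p a) + countᵇ p xs
    ≤⟨ +-mono-≤ (𝟙-≤ (p a) (p⇒q a)) (count-≤-sum-count p q p⇒q xs) ⟩
  sum (tabulate (λ i → 𝟙 (q i a))) + sum (tabulate (λ i → countᵇ (q i) xs))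
    ≡⟨ sum-tabulate-+ (λ i → 𝟙 (q i a)) _ ⟨
  sum (tabulate (λ i → countᵇ (q i) (a ∷ xs))) ∎
  where
  open ≤-Reasoning
  𝟙-≤ : ∀ b → (T b → ∃ λ i → T (q i a)) → 𝟙 b ≤ sum (tabulate (λ i → 𝟙 (q i a)))
  𝟙-≤ false _ = z≤n
  𝟙-≤ true some with some tt
  ... | i , qia = ≤-trans (T⇒1≤𝟙 qia) (≤-sum-tabulate (λ i → 𝟙 (q i a)) i)

combine : ∀ {n} → Subset n → Assignment n → Assignment n → Assignment n
combine S σ y = Vec.tabulate (λ j → if lookup S j then lookup σ j else lookup y j)

lookup-combine : ∀ {n} (S : Subset n) σ y j →
  lookup (combine S σ y) j ≡ (if lookup S j then lookup σ j else lookup y j)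
lookup-combine S σ y = lookup∘tabulate (λ j → if lookup S j then lookup σ j else lookup y j)

lookup-combine-inside : ∀ {n} (S : Subset n) σ y j →
  lookup S j ≡ true → lookup (combine S σ y) j ≡ lookup σ j
lookup-combine-inside S σ y j j∈S rewrite lookup-combine S σ y j | j∈S = refl

lookup-combine-outside : ∀ {n} (S : Subset n) σ y j →
  lookup S j ≡ false → lookup (combine S σ y) j ≡ lookup y j
lookup-combine-outside S σ y j j∉S rewrite lookup-combine S σ y j | j∉S = refl

fibreWeight : ∀ {n} → Subset n → (Assignment n → ℕ) → Assignment n → Assignment n → ℕ
fibreWeight S w σ y = if fixedOn S y then w (combine S σ y) else 0

-- Each x is combine S σ y for 2 ^ ∣ S ∣ choices of σ (only σ on S matters) and one y that is
-- +1 on S.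
sum-≤-fibres : ∀ {n} (S : Subset n) (w : Assignment n → ℕ) B →
  (∀ σ → sum (map (fibreWeight S w σ) (allAssignments n)) ≤ B) →
  sum (map w (allAssignments n)) ≤ 2 ^ ∣ S ∣ * B
sum-≤-fibres {zero} [] w B fibre≤B = ≤-trans (fibre≤B []) (≤-reflexive (sym (*-identityˡ B)))
sum-≤-fibres {suc n} (true ∷ S) w B fibre≤B = begin
  sum (map w (allAssignments (suc n)))
    ≡⟨ sum-allAssignments-suc w ⟩
  sum (map (w ∘ (false ∷_)) xs) + sum (map (w ∘ (true ∷_)) xs)
    ≤⟨ +-mono-≤ (sum-≤-fibres S (w ∘ (false ∷_)) B (fibre≤B′ false))
                (sum-≤-fibres S (w ∘ (true ∷_)) B (fibre≤B′ true)) ⟩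
  2 ^ ∣ S ∣ * B + 2 ^ ∣ S ∣ * B
    ≡⟨ cong (2 ^ ∣ S ∣ * B +_) (+-identityʳ (2 ^ ∣ S ∣ * B)) ⟨
  2 * (2 ^ ∣ S ∣ * B)
    ≡⟨ *-assoc 2 (2 ^ ∣ S ∣) B ⟨
  2 ^ ∣ true ∷ S ∣ * B ∎
  where
  open ≤-Reasoning
  xs = allAssignments n
  fibre≤B′ : ∀ c σ → sum (map (fibreWeight S (w ∘ (c ∷_)) σ) xs) ≤ B
  fibre≤B′ c σ = ≤-trans (m≤m+n _ _)
    (≤-trans (≤-reflexive (sym (sum-allAssignments-suc (fibreWeight (true ∷ S) w (c ∷ σ)))))
             (fibre≤B (c ∷ σ)))
sum-≤-fibres {suc n} (false ∷ S) w B fibre≤B = begin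
  sum (map w (allAssignments (suc n)))
    ≡⟨ sum-allAssignments-suc w ⟩
  sum (map (w ∘ (false ∷_)) xs) + sum (map (w ∘ (true ∷_)) xs)
    ≡⟨ sum-map-+ (w ∘ (false ∷_)) (w ∘ (true ∷_)) xs ⟨
  sum (map w′ xs)
    ≤⟨ sum-≤-fibres S w′ B fibre≤B′ ⟩
  2 ^ ∣ S ∣ * B ∎
  where
  open ≤-Reasoning
  xs = allAssignments n
  w′ : Assignment n → ℕ
  w′ y = w (false ∷ y) + w (true ∷ y)
  if-+ : ∀ b (m m′ : ℕ) → (if b then m + m′ else 0) ≡ (if b then m else 0) + (if b then m′ else 0)
  if-+ true m m′ = refl
  if-+ false m m′ = refl
  fibre≤B′ : ∀ σ → sum (map (fibreWeight S w′ σ) xs) ≤ B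
  fibre≤B′ σ = ≤-trans (≤-reflexive (begin-equality
    sum (map (fibreWeight S w′ σ) xs)
      ≡⟨ cong sum (map-cong (λ y → if-+ (fixedOn S y) _ _) xs) ⟩
    sum (map (λ y → fibreWeight S (w ∘ (false ∷_)) σ y + fibreWeight S (w ∘ (true ∷_)) σ y) xs)
      ≡⟨ sum-map-+ (fibreWeight S (w ∘ (false ∷_)) σ) (fibreWeight S (w ∘ (true ∷_)) σ) xs ⟩
    sum (map (fibreWeight S (w ∘ (false ∷_)) σ) xs) + sum (map (fibreWeight S (w ∘ (true ∷_)) σ) xs)
      ≡⟨ sum-allAssignments-suc (fibreWeight (false ∷ S) w (false ∷ σ)) ⟨
    sum (map (fibreWeight (false ∷ S) w (false ∷ σ)) (allAssignments (suc n))) ∎))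
    (fibre≤B (false ∷ σ))

count-≤-fibres : ∀ {n} (S : Subset n) (h : Assignment n → Bool)
  (g : Assignment n → Assignment n → Bool) B →
  (∀ σ y → h (combine S σ y) ≡ g σ y) →
  (∀ σ → countᵇ (λ y → fixedOn S y ∧ g σ y) (allAssignments n) ≤ B) →
  countᵇ h (allAssignments n) ≤ 2 ^ ∣ S ∣ * B
count-≤-fibres {n} S h g B h≡g fibre≤B = begin
  countᵇ h xs            ≡⟨ countᵇ≡sum-𝟙 h xs ⟩
  sum (map (𝟙 ∘ h) xs)   ≤⟨ sum-≤-fibres S (𝟙 ∘ h) B fibre≤B′ ⟩
  2 ^ ∣ S ∣ * B          ∎
  where
  open ≤-Reasoning
  xs = allAssignments n
  if-𝟙 : ∀ a {b c} → b ≡ c → (if a then 𝟙 b else 0) ≡ 𝟙 (a ∧ c)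
  if-𝟙 true b≡c = cong 𝟙 b≡c
  if-𝟙 false _ = refl
  fibre≤B′ : ∀ σ → sum (map (fibreWeight S (𝟙 ∘ h) σ) xs) ≤ B
  fibre≤B′ σ = ≤-trans (≤-reflexive (begin-equality
    sum (map (fibreWeight S (𝟙 ∘ h) σ) xs)
      ≡⟨ cong sum (map-cong (λ y → if-𝟙 (fixedOn S y) (h≡g σ y)) xs) ⟩
    sum (map (𝟙 ∘ (λ y → fixedOn S y ∧ g σ y)) xs)
      ≡⟨ countᵇ≡sum-𝟙 _ xs ⟨
    countᵇ (λ y → fixedOn S y ∧ g σ y) xs ∎)) (fibre≤B σ)

violations-++ : ∀ {n k} (x : Assignment n) (J K : KXOR n k) →
  violations x (J ++ K) ≡ violations x J + violations x K
violations-++ x [] K = refl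
violations-++ x (c ∷ J) K =
  trans (cong (_ +_) (violations-++ x J K)) (sym (+-assoc (if satisfiesᵇ x c then 0 else 1) _ _))

violations-cong : ∀ {n k} {x y : Assignment n} {J : KXOR n k} →
  All (λ c → prodOn x (proj₂ c) ≡ prodOn y (proj₂ c)) J → violations x J ≡ violations y J
violations-cong [] = refl
violations-cong {J = (b , U) ∷ J} (x≡y ∷ x≡ys) =
  cong₂ _+_ (cong (λ s → if not (s xor b) then 0 else 1) x≡y) (violations-cong x≡ys)

prodOn-cong-outside : ∀ {n k} (S : Subset n) (x y : Assignment n) (U : Vec (Fin n) k) →
  (∀ j → lookup S j ≡ false → lookup x j ≡ lookup y j) →
  allOutside U S ≡ true → prodOn x U ≡ prodOn y U
prodOn-cong-outside S x y [] x≡y _ = refl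
prodOn-cong-outside S x y (u ∷ U) x≡y U-out with u ∈ᵇ S in u∉S
... | false = cong₂ _xor_ (x≡y u u∉S) (prodOn-cong-outside S x y U x≡y U-out)

inducedC-outside : ∀ {n k} (S : Subset n) σ (c : Constraint n k) →
  All (λ c′ → allOutside (proj₂ c′) S ≡ true) (inducedC S σ c)
inducedC-outside S σ (b , []) = []
inducedC-outside S σ (b , u ∷ U) with u ∈ᵇ S | allOutside U S in U-out
... | true | true = U-out ∷ []
... | true | false = []
... | false | _ = []

induced-outside : ∀ {n k} (I : KXOR n k) (S : Subset n) σ →
  All (λ c → allOutside (proj₂ c) S ≡ true) (induced I S σ)
induced-outside [] S σ = []
induced-outside (c ∷ I) S σ = ++⁺ (inducedC-outside S σ c) (induced-outside I S σ)

inducedC-cong-inside : ∀ {n k} (S : Subset n) {σ σ′ : Assignment n} →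
  (∀ j → lookup S j ≡ true → lookup σ j ≡ lookup σ′ j) →
  (c : Constraint n k) → inducedC S σ c ≡ inducedC S σ′ c
inducedC-cong-inside S σ≡σ′ (b , []) = refl
inducedC-cong-inside S σ≡σ′ (b , u ∷ U) with u ∈ᵇ S in u∈S
... | false = refl
... | true rewrite σ≡σ′ u u∈S = refl

induced-cong-inside : ∀ {n k} (I : KXOR n k) (S : Subset n) {σ σ′ : Assignment n} →
  (∀ j → lookup S j ≡ true → lookup σ j ≡ lookup σ′ j) → induced I S σ ≡ induced I S σ′
induced-cong-inside [] S σ≡σ′ = refl
induced-cong-inside (c ∷ I) S σ≡σ′ =
  cong₂ _++_ (inducedC-cong-inside S σ≡σ′ c) (induced-cong-inside I S σ≡σ′)

violations-induced-combine : ∀ {n k} (I : KXOR n k) (S : Subset n) σ y →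
  violations (combine S σ y) (induced I S (combine S σ y)) ≡ violations y (induced I S σ)
violations-induced-combine I S σ y =
  trans (cong (violations (combine S σ y)) (induced-cong-inside I S (lookup-combine-inside S σ y)))
        (violations-cong (All.map (λ {c} → prodOn-cong-outside S (combine S σ y) y (proj₂ c) y-off)
                                  (induced-outside I S σ)))
  where
  y-off : ∀ j → lookup S j ≡ false → lookup (combine S σ y) j ≡ lookup y j
  y-off = lookup-combine-outside S σ y

inducedC-absent : ∀ {n k} (S : Subset n) σ (b : Sign) u (U : Vec (Fin n) k) →
  u ∈ᵇ S ≡ false → inducedC S σ (b , u ∷ U) ≡ []
inducedC-absent S σ b u U u∉S rewrite u∉S = refl

-- Substituting x itself for σ turns c into an equivalent constraint.
violations-inducedC-self : ∀ {n k} (S : Subset n) x (c : Constraint n k) →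
  violations x (inducedC S x c) ≤ violations x (c ∷ [])
violations-inducedC-self S x (b , []) = z≤n
violations-inducedC-self S x (b , u ∷ U) with u ∈ᵇ S ∧ allOutside U S
... | false = z≤n
... | true =
  ≤-reflexive (cong (λ s → (if not s then 0 else 1) + 0) (xor-shift (prodOn x U) b (lookup x u)))
  where
  xor-shift : ∀ p b a → p xor (b xor a) ≡ (a xor p) xor b
  xor-shift p b a = begin
    p xor (b xor a) ≡⟨ xor-comm p _ ⟩
    (b xor a) xor p ≡⟨ xor-assoc b a p ⟩
    b xor (a xor p) ≡⟨ xor-comm b _ ⟩
    (a xor p) xor b ∎
    where open ≡-Reasoning

module _ {n ℓ : ℕ} (S : Fin ℓ → Subset n)
  (cover : ∀ j → Σ (Fin ℓ) (λ i → lookup (S i) j ≡ true))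
  (disjoint : ∀ i i′ j → lookup (S i) j ≡ true → lookup (S i′) j ≡ true → i ≡ i′) where

  sum-violations-inducedC-≤ : ∀ {k} x (c : Constraint n k) →
    sum (tabulate (λ i → violations x (inducedC (S i) x c))) ≤ violations x (c ∷ [])
  sum-violations-inducedC-≤ x (b , []) =
    ≤-trans (≤-reflexive (sum-tabulate-0 {ℓ} (λ _ → 0) (λ _ → refl))) z≤n
  sum-violations-inducedC-≤ x c@(b , u ∷ U) = begin
    sum (tabulate (λ i → violations x (inducedC (S i) x c)))
      ≡⟨ sum-tabulate-single _ i₀ (λ i i≢i₀ →
           cong (violations x) (inducedC-absent (S i) x b u U (u∉Si i≢i₀))) ⟩
    violations x (inducedC (S i₀) x c)
      ≤⟨ violations-inducedC-self (S i₀) x c ⟩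
    violations x (c ∷ []) ∎
    where
    open ≤-Reasoning
    i₀ = proj₁ (cover u)
    u∉Si : ∀ {i} → i ≢ i₀ → lookup (S i) u ≡ false
    u∉Si {i} i≢i₀ = ¬-not (λ u∈Si → i≢i₀ (disjoint i i₀ u u∈Si (proj₂ (cover u))))

  sum-violations-induced-≤ : ∀ {k} x (I : KXOR n k) →
    sum (tabulate (λ i → violations x (induced I (S i) x))) ≤ violations x I
  sum-violations-induced-≤ x [] = ≤-reflexive (sum-tabulate-0 {ℓ} (λ _ → 0) (λ _ → refl))
  sum-violations-induced-≤ x (c ∷ I) = begin
    sum (tabulate (λ i → violations x (inducedC (S i) x c ++ induced I (S i) x)))
      ≡⟨ cong sum (tabulate-cong (λ i → violations-++ x (inducedC (S i) x c) (induced I (S i) x))) ⟩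
    sum (tabulate (λ i → violations x (inducedC (S i) x c) + violations x (induced I (S i) x)))
      ≡⟨ sum-tabulate-+ (λ i → violations x (inducedC (S i) x c)) _ ⟩
    sum (tabulate (λ i → violations x (inducedC (S i) x c)))
      + sum (tabulate (λ i → violations x (induced I (S i) x)))
      ≤⟨ +-mono-≤ (sum-violations-inducedC-≤ x c) (sum-violations-induced-≤ x I) ⟩
    violations x (c ∷ []) + violations x I
      ≡⟨ violations-++ x (c ∷ []) I ⟨
    violations x (c ∷ I) ∎
    where open ≤-Reasoning

  ∃-block-violations-≤ : ∀ {k} .{{_ : NonZero ℓ}} (I : KXOR n k) x {t} → violations x I ≤ t →
    ∃ λ i → violations x (induced I (S i) x) ≤ t / ℓ
  ∃-block-violations-≤ I x {t} x-low with ∃-≤-average ℓ (λ i → violations x (induced I (S i) x))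
  ... | i , vᵢ*ℓ≤ = i , (begin
    violations x (induced I (S i) x)
      ≡⟨ m*n/n≡m _ ℓ ⟨
    violations x (induced I (S i) x) * ℓ / ℓ
      ≤⟨ /-monoˡ-≤ ℓ (≤-trans vᵢ*ℓ≤ (≤-trans (sum-violations-induced-≤ x I) x-low)) ⟩
    t / ℓ ∎)
    where open ≤-Reasoning

lemma4p6 : (n k : ℕ) → 2 ≤ k → (I : KXOR n k)
    → (ℓ : ℕ) → .{{_ : NonZero ℓ}} → (S : Fin ℓ → Subset n)
    → (∀ j → Σ (Fin ℓ) (λ i → lookup (S i) j ≡ true))
    → (∀ i i′ j → lookup (S i) j ≡ true → lookup (S i′) j ≡ true → i ≡ i′)
    → (t : ℕ) → (u : Fin ℓ → ℕ)
    → (∀ i (σ : Assignment n) →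
         countLowViolationOff (S i) (induced I (S i) σ) ((k * t) / ℓ) ≤ u i)
    → countLowViolation I t ≤ sum (tabulate {n = ℓ} (λ i → 2 ^ ∣ S i ∣ * u i))
lemma4p6 n k@(suc _) (s≤s _) I ℓ S cover disjoint t u fibre≤u = begin
  countLowViolation I t
    ≤⟨ count-≤-sum-count (λ x → violations x I ≤ᵇ t) low some-block-low (allAssignments n) ⟩
  sum (tabulate (λ i → countᵇ (low i) (allAssignments n)))
    ≤⟨ sum-tabulate-mono (λ i → count-≤-fibres (S i) (low i) (lowFibre i) (u i)
                                  (λ σ y → cong (_≤ᵇ m) (violations-induced-combine I (S i) σ y))
                                  (fibre≤u i)) ⟩
  sum (tabulate (λ i → 2 ^ ∣ S i ∣ * u i)) ∎
  where
  open ≤-Reasoning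
  m = k * t / ℓ
  low : Fin ℓ → Assignment n → Bool
  low i x = violations x (induced I (S i) x) ≤ᵇ m
  lowFibre : Fin ℓ → Assignment n → Assignment n → Bool
  lowFibre i σ y = violations y (induced I (S i) σ) ≤ᵇ m
  some-block-low : ∀ x → T (violations x I ≤ᵇ t) → ∃ λ i → T (low i x)
  some-block-low x x-low with ∃-block-violations-≤ S cover disjoint I x (≤ᵇ⇒≤ _ t x-low)
  ... | i , vᵢ≤ = i , ≤⇒≤ᵇ (≤-trans vᵢ≤ (/-monoˡ-≤ ℓ (m≤n*m t k)))
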